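{- Let $\mathcal{G}=(V,E,\mathcal{E})$ be an extended graph and let $u,v\in V$ be distinct vertices such that $N[v]\subseteq N[u]$ and $\deg_2(v)+\deg(v)\le\deg(u)$. Then there is a maximum 2-packing set of $\mathcal{G}$ that does not contain $u$. In particular, with $\mathcal{G}'=\mathcal{G}[V\setminus\{u\}]$, we have $\beta(\mathcal{G})=\beta(\mathcal{G}')$.
   Context: Let $H=(V_H,E_H)$ be a finite simple undirected graph and let $\mathcal{E}_H$ be the set of unordered pairs $\{x,y\}$ of distinct vertices with $\{x,y\}\notin E_H$ that have a common neighbor in $H$. An extended graph $\mathcal{G}=(V,E,\mathcal{E})$ is obtained from such an $H$ by choosing $V\subseteq V_H$ and letting $E$ (resp. $\mathcal{E}$) be the pairs of $E_H$ (resp. $\mathcal{E}_H$) with both endpoints in $V$. For $U\subseteq V$, $\mathcal{G}[U]$ denotes the extended graph on $U$ keeping exactly the pairs of $E$ and of $\mathcal{E}$ with both endpoints in $U$. For $v\in V$: $N(v)=\{x:\{x,v\}\in E\}$, $N[v]=N(v)\cup\{v\}$, $\deg(v)=|N(v)|$, $N^2(v)=\{x:\{x,v\}\in\mathcal{E}\}$, $\deg_2(v)=|N^2(v)|$. A 2-packing set of $\mathcal{G}$ is a set $S\subseteq V$ such that no two distinct vertices of $S$ form a pair in $E\cup\mathcal{E}$; a maximum 2-packing set is one of maximum cardinality, and $\beta(\mathcal{G})$ is this maximum cardinality. -}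

module Defs where

open import Data.Nat using (ℕ; _≤_)
open import Data.Bool using (Bool; true; false; _∧_; _∨_; not)
open import Data.Fin using (Fin)
open import Data.Fin.Properties using () renaming (_≟_ to _≟ᶠ_)
open import Data.Fin.Subset using (Subset; _∈_; _∉_; _⊆_; ∣_∣; _-_)
open import Data.Vec using (lookup; tabulate)
open import Data.List using (allFin)
open import Data.Bool.ListAction using (any)
open import Data.Product using (Σ; _×_; ∃)
open import Relation.Nullary using (¬_)
open import Relation.Nullary.Decidable using (⌊_⌋)
open import Relation.Binary.PropositionalEquality using (_≡_)

record SimpleGraph (n : ℕ) : Set where
  field
    adj     : Fin n → Fin n → Bool
    adj-sym : ∀ x y → adj x y ≡ adj y x
    adj-irr : ∀ x → adj x x ≡ false

-- An extended graph: a simple graph H together with a vertex set V ⊆ V_H.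
-- E = edges of H inside V; ℰ = non-adjacent distinct pairs inside V
-- having a common neighbour in H (anywhere in V_H).
record ExtGraph (n : ℕ) : Set where
  field
    H : SimpleGraph n
    V : Subset n

module _ {n : ℕ} (G : ExtGraph n) where
  open ExtGraph G
  open SimpleGraph H

  inV : Fin n → Bool
  inV x = lookup V x

  commonNbr : Fin n → Fin n → Bool
  commonNbr x y = any (λ w → adj x w ∧ adj w y) (allFin n)

  isE : Fin n → Fin n → Bool
  isE x y = inV x ∧ inV y ∧ adj x y

  isℰ : Fin n → Fin n → Bool
  isℰ x y = inV x ∧ inV y ∧ not ⌊ x ≟ᶠ y ⌋ ∧ not (adj x y) ∧ commonNbr x y

  N : Fin n → Subset n
  N v = tabulate (λ x → isE x v)

  N[_] : Fin n → Subset n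
  N[ v ] = tabulate (λ x → isE x v ∨ (inV x ∧ ⌊ x ≟ᶠ v ⌋))

  N² : Fin n → Subset n
  N² v = tabulate (λ x → isℰ x v)

  deg : Fin n → ℕ
  deg v = ∣ N v ∣

  deg₂ : Fin n → ℕ
  deg₂ v = ∣ N² v ∣

  Is2Packing : Subset n → Set
  Is2Packing S = S ⊆ V × (∀ x y → x ∈ S → y ∈ S → ¬ (x ≡ y) →
                            (isE x y ≡ false) × (isℰ x y ≡ false))

  IsMax2Packing : Subset n → Set
  IsMax2Packing S = Is2Packing S × (∀ T → Is2Packing T → ∣ T ∣ ≤ ∣ S ∣)

  HasPackingNumber : ℕ → Set
  HasPackingNumber k = (∃ λ S → Is2Packing S × ∣ S ∣ ≡ k)
                     × (∀ T → Is2Packing T → ∣ T ∣ ≤ k)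

induced : ∀ {n} → ExtGraph n → Subset n → ExtGraph n
induced G U = record { H = ExtGraph.H G ; V = U }

deleteVertex : ∀ {n} → ExtGraph n → Fin n → ExtGraph n
deleteVertex G u = induced G (ExtGraph.V G - u)

module Submission where

-- Since v ∈ N(u), the ball B = {v} ∪ N(v) ∪ N²(v) contains u and all of N(u), and
-- |B| ≤ 1 + deg v + deg₂ v ≤ 1 + deg u. A vertex of N²(v) outside N(u) would be one element
-- too many in B, so N²(v) ⊆ N(u). Together with N[v] ⊆ N[u], every vertex other than u that is
-- far from u is also far from v, so replacing u by v in a maximum 2-packing gives a maximum
-- 2-packing avoiding u. Such a packing is also maximum in G − u, whence β(G) = β(G − u).

open import Defs
open import Algebra.Bundles using (CommutativeMonoid)
open import Data.Bool using (Bool; true; false; _∧_; _∨_; not)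
open import Data.Bool.ListAction using (or)
open import Data.Bool.Properties
  using (∧-conicalˡ; ∧-conicalʳ; ∧-comm; ∧-commutativeMonoid; ∨-zeroʳ; not-injective; ¬-not; T-≡)
  renaming (_≟_ to _≟ᵇ_)
open import Algebra.Properties.CommutativeSemigroup
  (CommutativeMonoid.commutativeSemigroup ∧-commutativeMonoid) using (x∙yz≈y∙xz)
open import Data.Fin using (Fin; zero; suc)
open import Data.Fin.Properties using (all?) renaming (_≟_ to _≟ᶠ_)
open import Data.Fin.Subset
  using (Subset; inside; outside; _∈_; _∉_; _⊆_; _⊂_; _∪_; _-_; ⁅_⁆; ∣_∣; ⊥)
open import Data.Fin.Subset.Properties
  using (∣p∣≤n; ∣p∣≤∣x∷p∣; ∣⁅x⁆∣≡1; p⊆q⇒∣p∣≤∣q∣; p⊂q⇒∣p∣<∣q∣; x∈p⇒∣p-x∣<∣p∣; x∈⁅x⁆; x∈⁅y⁆⇒x≡y;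
         x∈p∪q⁺; x∈p∪q⁻; p─q⊆p; x∈p∧x≢y⇒x∈p-y; ∉⊥; anySubset?; _⊆?_; _∈?_)
open import Data.List using (allFin)
open import Data.List.Membership.Propositional using (lose)
open import Data.List.Membership.Propositional.Properties using (∈-allFin)
open import Data.List.Properties using (map-cong)
open import Data.List.Relation.Unary.Any.Properties using (any⁺)
open import Data.Nat using (ℕ; zero; suc; _+_; _≤_; _<_; z≤n; s≤s; _≤?_)
open import Data.Nat.Properties
open import Data.Product using (∃; _×_; _,_; proj₁; proj₂)
open import Data.Sum using (_⊎_; inj₁; inj₂)
open import Data.Vec using ([]; _∷_; there; tabulate)
open import Data.Vec.Properties using (lookup∘tabulate; []=⇒lookup; lookup⇒[]=)
open import Function using (_∘_; id; Equivalence)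
open import Function.Bundles using (_⇔_; mk⇔)
open import Relation.Nullary using (¬_; yes; no; contradiction)
open import Relation.Nullary.Decidable using (⌊_⌋; toWitness; _×-dec_; _→-dec_; ¬?)
open import Relation.Unary using (Decidable)
open import Relation.Binary.PropositionalEquality

∣p∪q∣≤∣p∣+∣q∣ : ∀ {n} (p q : Subset n) → ∣ p ∪ q ∣ ≤ ∣ p ∣ + ∣ q ∣
∣p∪q∣≤∣p∣+∣q∣ []            []            = z≤n
∣p∪q∣≤∣p∣+∣q∣ (inside ∷ p)  (s ∷ q)       =
  s≤s (≤-trans (∣p∪q∣≤∣p∣+∣q∣ p q) (+-monoʳ-≤ ∣ p ∣ (∣p∣≤∣x∷p∣ s q)))
∣p∪q∣≤∣p∣+∣q∣ (outside ∷ p) (inside ∷ q)  =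
  ≤-trans (s≤s (∣p∪q∣≤∣p∣+∣q∣ p q)) (≤-reflexive (sym (+-suc ∣ p ∣ ∣ q ∣)))
∣p∪q∣≤∣p∣+∣q∣ (outside ∷ p) (outside ∷ q) = ∣p∪q∣≤∣p∣+∣q∣ p q

x∉p-x : ∀ {n} (p : Subset n) (x : Fin n) → x ∉ p - x
x∉p-x (_ ∷ p) zero    ()
x∉p-x (_ ∷ p) (suc x) (there x∈p-x) = x∉p-x p x x∈p-x

x∈p-y⇒x≢y : ∀ {n} {p : Subset n} {x y : Fin n} → x ∈ p - y → x ≢ y
x∈p-y⇒x≢y {p = p} {x} x∈p-x refl = x∉p-x p x x∈p-x

∈-tabulate⁺ : ∀ {n} {f : Fin n → Bool} {x} → f x ≡ true → x ∈ tabulate f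
∈-tabulate⁺ {f = f} {x} fx = lookup⇒[]= x (tabulate f) (trans (lookup∘tabulate f x) fx)

∈-tabulate⁻ : ∀ {n} {f : Fin n → Bool} {x} → x ∈ tabulate f → f x ≡ true
∈-tabulate⁻ {f = f} {x} x∈ = trans (sym (lookup∘tabulate f x)) ([]=⇒lookup x∈)

∉-tabulate⁺ : ∀ {n} {f : Fin n → Bool} {x} → f x ≡ false → x ∉ tabulate f
∉-tabulate⁺ fx x∈ with () ← trans (sym fx) (∈-tabulate⁻ x∈)

∉-tabulate⁻ : ∀ {n} {f : Fin n → Bool} {x} → x ∉ tabulate f → f x ≡ false
∉-tabulate⁻ x∉ = ¬-not (x∉ ∘ ∈-tabulate⁺)

greatest-bounded : ∀ {P : ℕ → Set} → Decidable P → ∀ k → P 0 → (∀ {j} → P j → j ≤ k) →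
                   ∃ λ m → P m × (∀ {j} → P j → j ≤ m)
greatest-bounded P? k p₀ bound with P? k
... | yes pk = k , pk , bound
greatest-bounded P? zero    p₀ bound | no ¬pk = contradiction p₀ ¬pk
greatest-bounded {P} P? (suc k) p₀ bound | no ¬pk = greatest-bounded P? k p₀ bound′
  where
  bound′ : ∀ {j} → P j → j ≤ k
  bound′ pj = ≤-pred (≤∧≢⇒< (bound pj) λ { refl → ¬pk pj })

maximum-subset : ∀ {n} {P : Subset n → Set} → Decidable P → ∀ {S₀} → P S₀ →
                 ∃ λ S → P S × (∀ T → P T → ∣ T ∣ ≤ ∣ S ∣)
maximum-subset {n} {P} P? {S₀} p₀ =
  maximum (greatest-bounded Large? n (S₀ , p₀ , z≤n) (λ (S , _ , j≤∣S∣) → ≤-trans j≤∣S∣ (∣p∣≤n S)))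
  where
  Large : ℕ → Set
  Large m = ∃ λ S → P S × m ≤ ∣ S ∣

  Large? : Decidable Large
  Large? m = anySubset? (λ S → P? S ×-dec (m ≤? ∣ S ∣))

  maximum : (∃ λ m → Large m × (∀ {j} → Large j → j ≤ m)) →
            ∃ λ S → P S × (∀ T → P T → ∣ T ∣ ≤ ∣ S ∣)
  maximum (m , (S , pS , m≤∣S∣) , greatest) =
    S , pS , λ T pT → ≤-trans (greatest (T , pT , ≤-refl)) m≤∣S∣

⌊≟⌋-sym : ∀ {n} (x y : Fin n) → ⌊ x ≟ᶠ y ⌋ ≡ ⌊ y ≟ᶠ x ⌋
⌊≟⌋-sym x y with x ≟ᶠ y | y ≟ᶠ x
... | yes _   | yes _   = refl
... | no _    | no _    = refl
... | yes x≡y | no y≢x  = contradiction (sym x≡y) y≢x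
... | no x≢y  | yes y≡x = contradiction (sym y≡x) x≢y

module _ {n : ℕ} (G : ExtGraph n) where
  open ExtGraph G
  open SimpleGraph H

  isE-sym : ∀ x y → isE G x y ≡ isE G y x
  isE-sym x y rewrite adj-sym x y = x∙yz≈y∙xz (inV G x) (inV G y) (adj y x)

  commonNbr-sym : ∀ x y → commonNbr G x y ≡ commonNbr G y x
  commonNbr-sym x y = cong or (map-cong swap (allFin n))
    where
    swap : ∀ w → (adj x w ∧ adj w y) ≡ (adj y w ∧ adj w x)
    swap w rewrite adj-sym x w | adj-sym w y = ∧-comm (adj w x) (adj y w)

  isℰ-sym : ∀ x y → isℰ G x y ≡ isℰ G y x
  isℰ-sym x y rewrite ⌊≟⌋-sym x y | adj-sym x y | commonNbr-sym x y =
    x∙yz≈y∙xz (inV G x) (inV G y) _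

  isE-intro : ∀ {x y} → x ∈ V → y ∈ V → adj x y ≡ true → isE G x y ≡ true
  isE-intro x∈V y∈V xy rewrite []=⇒lookup x∈V | []=⇒lookup y∈V = xy

  N⊆V : ∀ {y} → N G y ⊆ V
  N⊆V {y} {x} x∈Ny = lookup⇒[]= x V (∧-conicalˡ (inV G x) _ (∈-tabulate⁻ x∈Ny))

  ∈N⇒adj : ∀ {x y} → x ∈ N G y → adj x y ≡ true
  ∈N⇒adj {x} {y} x∈Ny = ∧-conicalʳ (inV G y) _ (∧-conicalʳ (inV G x) _ (∈-tabulate⁻ x∈Ny))

  commonNbr-intro : ∀ {x y} w → adj x w ≡ true → adj w y ≡ true → commonNbr G x y ≡ true
  commonNbr-intro w xw wy =
    Equivalence.to T-≡ (any⁺ _ (lose (∈-allFin w) (Equivalence.from T-≡ (cong₂ _∧_ xw wy))))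

  isℰ-intro : ∀ {x y} w → x ∈ V → y ∈ V → x ≢ y → adj x y ≡ false →
              adj x w ≡ true → adj w y ≡ true → isℰ G x y ≡ true
  isℰ-intro {x} {y} w x∈V y∈V x≢y ¬xy xw wy
    rewrite []=⇒lookup x∈V | []=⇒lookup y∈V | ≢-≟-identity _≟ᶠ_ x≢y | ¬xy =
    commonNbr-intro w xw wy

  isℰ⇒¬adj : ∀ {x y} → isℰ G x y ≡ true → adj x y ≡ false
  isℰ⇒¬adj {x} {y} e =
    not-injective (∧-conicalˡ (not (adj x y)) _
      (∧-conicalʳ (not ⌊ x ≟ᶠ y ⌋) _ (∧-conicalʳ (inV G y) _ (∧-conicalʳ (inV G x) _ e))))

  N-irrefl : ∀ {x y} → x ∈ N G y → x ≢ y
  N-irrefl {x} x∈Ny refl with () ← trans (sym (adj-irr x)) (∈N⇒adj x∈Ny)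

  N-sym : ∀ {x y} → x ∈ N G y → y ∈ N G x
  N-sym {x} {y} x∈Ny = ∈-tabulate⁺ (trans (isE-sym y x) (∈-tabulate⁻ x∈Ny))

  N⊆N[] : ∀ {v} → N G v ⊆ N[_] G v
  N⊆N[] {v} {x} x∈Nv = ∈-tabulate⁺ (cong (_∨ (inV G x ∧ ⌊ x ≟ᶠ v ⌋)) (∈-tabulate⁻ x∈Nv))

  v∈N[v] : ∀ {v} → v ∈ V → v ∈ N[_] G v
  v∈N[v] {v} v∈V = ∈-tabulate⁺ (trans (cong (isE G v v ∨_) v≡v) (∨-zeroʳ (isE G v v)))
    where
    v≡v : inV G v ∧ ⌊ v ≟ᶠ v ⌋ ≡ true
    v≡v rewrite []=⇒lookup v∈V | ≡-≟-identity _≟ᶠ_ (refl {x = v}) = refl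

  ∈N[]⁻ : ∀ {x v} → x ∈ N[_] G v → x ∈ N G v ⊎ x ≡ v
  ∈N[]⁻ {x} {v} x∈N[v] with isE G x v in xv | ∈-tabulate⁻ x∈N[v]
  ... | true  | _   = inj₁ (∈-tabulate⁺ xv)
  ... | false | x≈v = inj₂ (toWitness (Equivalence.from T-≡ (∧-conicalʳ (inV G x) _ x≈v)))

  ∈N-dominating : ∀ {u v x} → N[_] G v ⊆ N[_] G u → x ∈ N G v → x ≢ u → x ∈ N G u
  ∈N-dominating N[v]⊆N[u] x∈Nv x≢u with ∈N[]⁻ (N[v]⊆N[u] (N⊆N[] x∈Nv))
  ... | inj₁ x∈Nu = x∈Nu
  ... | inj₂ x≡u  = contradiction x≡u x≢u

  ∈N-dominated : ∀ {u v} → v ∈ V → u ≢ v → N[_] G v ⊆ N[_] G u → v ∈ N G u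
  ∈N-dominated v∈V u≢v N[v]⊆N[u] with ∈N[]⁻ (N[v]⊆N[u] (v∈N[v] v∈V))
  ... | inj₁ v∈Nu = v∈Nu
  ... | inj₂ v≡u  = contradiction (sym v≡u) u≢v

  N⊆ball-of-neighbour : ∀ {u v} → v ∈ N G u → N G u ⊆ ⁅ v ⁆ ∪ (N G v ∪ N² G v)
  N⊆ball-of-neighbour {u} {v} v∈Nu {y} y∈Nu with y ≟ᶠ v | adj y v in yv
  ... | yes refl | _     = x∈p∪q⁺ (inj₁ (x∈⁅x⁆ v))
  ... | no _     | true  =
    x∈p∪q⁺ (inj₂ (x∈p∪q⁺ (inj₁ (∈-tabulate⁺ (isE-intro (N⊆V y∈Nu) (N⊆V v∈Nu) yv)))))
  ... | no y≢v   | false = x∈p∪q⁺ (inj₂ (x∈p∪q⁺ (inj₂ (∈-tabulate⁺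
    (isℰ-intro u (N⊆V y∈Nu) (N⊆V v∈Nu) y≢v yv (∈N⇒adj y∈Nu) (∈N⇒adj (N-sym v∈Nu)))))))

  N²⊆N-of-heavy-neighbour : ∀ {u v} → v ∈ N G u → deg₂ G v + deg G v ≤ deg G u →
                            N² G v ⊆ N G u
  N²⊆N-of-heavy-neighbour {u} {v} v∈Nu deg-bound {x} x∈N²v with x ∈? N G u
  ... | yes x∈Nu = x∈Nu
  ... | no  x∉Nu = contradiction too-many (<-irrefl refl)
    where
    Ball : Subset n
    Ball = ⁅ v ⁆ ∪ (N G v ∪ N² G v)

    u∈Ball : u ∈ Ball
    u∈Ball = x∈p∪q⁺ (inj₂ (x∈p∪q⁺ (inj₁ (N-sym v∈Nu))))

    x≢u : x ≢ u
    x≢u refl with () ← trans (sym (isℰ⇒¬adj (∈-tabulate⁻ x∈N²v))) (∈N⇒adj (N-sym v∈Nu))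

    x∈Ball-u : x ∈ Ball - u
    x∈Ball-u = x∈p∧x≢y⇒x∈p-y (x∈p∪q⁺ (inj₂ (x∈p∪q⁺ (inj₂ x∈N²v)))) x≢u

    Nu⊆Ball-u-x : N G u ⊆ Ball - u - x
    Nu⊆Ball-u-x y∈Nu =
      x∈p∧x≢y⇒x∈p-y (x∈p∧x≢y⇒x∈p-y (N⊆ball-of-neighbour v∈Nu y∈Nu) (N-irrefl y∈Nu))
                    λ { refl → x∉Nu y∈Nu }

    too-many : 1 + deg G u < 1 + deg G u
    too-many = begin-strict
      1 + deg G u                     ≤⟨ s≤s (p⊆q⇒∣p∣≤∣q∣ Nu⊆Ball-u-x) ⟩
      1 + ∣ Ball - u - x ∣            ≤⟨ x∈p⇒∣p-x∣<∣p∣ x∈Ball-u ⟩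
      ∣ Ball - u ∣                    <⟨ x∈p⇒∣p-x∣<∣p∣ u∈Ball ⟩
      ∣ Ball ∣                        ≤⟨ ∣p∪q∣≤∣p∣+∣q∣ ⁅ v ⁆ (N G v ∪ N² G v) ⟩
      ∣ ⁅ v ⁆ ∣ + ∣ N G v ∪ N² G v ∣  ≤⟨ +-mono-≤ (≤-reflexive (∣⁅x⁆∣≡1 v))
                                                   (∣p∪q∣≤∣p∣+∣q∣ (N G v) (N² G v)) ⟩
      1 + (deg G v + deg₂ G v)        ≡⟨ cong (1 +_) (+-comm (deg G v) (deg₂ G v)) ⟩
      1 + (deg₂ G v + deg G v)        ≤⟨ +-monoʳ-≤ 1 deg-bound ⟩
      1 + deg G u                     ∎
      where open ≤-Reasoning

  Separated : Fin n → Fin n → Set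
  Separated x y = (isE G x y ≡ false) × (isℰ G x y ≡ false)

  Separated-sym : ∀ {x y} → Separated x y → Separated y x
  Separated-sym {x} {y} (xy , xy²) = trans (isE-sym y x) xy , trans (isℰ-sym y x) xy²

  Is2Packing? : Decidable (Is2Packing G)
  Is2Packing? S = S ⊆? V ×-dec all? λ x → all? λ y →
    x ∈? S →-dec (y ∈? S →-dec (¬? (x ≟ᶠ y) →-dec (isE G x y ≟ᵇ false ×-dec isℰ G x y ≟ᵇ false)))

  module Exchange {u v : Fin n} (v∈Nu : v ∈ N G u) (N[v]⊆N[u] : N[_] G v ⊆ N[_] G u)
                  (N²v⊆Nu : N² G v ⊆ N G u)
                  {S : Subset n} (S-packing : Is2Packing G S) (u∈S : u ∈ S) where

    separated-from-dominated : ∀ {x} → x ∈ S → x ≢ u → Separated x v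
    separated-from-dominated {x} x∈S x≢u =
      ∉-tabulate⁻ (λ x∈Nv → x∉Nu (∈N-dominating N[v]⊆N[u] x∈Nv x≢u)) ,
      ∉-tabulate⁻ (x∉Nu ∘ N²v⊆Nu)
      where
      x∉Nu : x ∉ N G u
      x∉Nu = ∉-tabulate⁺ (proj₁ (proj₂ S-packing x u x∈S u∈S x≢u))

    exchanged : Subset n
    exchanged = ⁅ v ⁆ ∪ (S - u)

    exchanged-packing : Is2Packing G exchanged
    exchanged-packing = ⊆V , separated
      where
      ⊆V : exchanged ⊆ V
      ⊆V x∈ with x∈p∪q⁻ ⁅ v ⁆ (S - u) x∈
      ... | inj₁ x∈⁅v⁆ rewrite x∈⁅y⁆⇒x≡y v x∈⁅v⁆ = N⊆V v∈Nu
      ... | inj₂ x∈S-u = proj₁ S-packing (p─q⊆p S ⁅ u ⁆ x∈S-u)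

      separated : ∀ x y → x ∈ exchanged → y ∈ exchanged → x ≢ y → Separated x y
      separated x y x∈ y∈ x≢y with x∈p∪q⁻ ⁅ v ⁆ (S - u) x∈ | x∈p∪q⁻ ⁅ v ⁆ (S - u) y∈
      ... | inj₁ x∈⁅v⁆ | inj₁ y∈⁅v⁆ =
        contradiction (trans (x∈⁅y⁆⇒x≡y v x∈⁅v⁆) (sym (x∈⁅y⁆⇒x≡y v y∈⁅v⁆))) x≢y
      ... | inj₁ x∈⁅v⁆ | inj₂ y∈S-u rewrite x∈⁅y⁆⇒x≡y v x∈⁅v⁆ =
        Separated-sym (separated-from-dominated (p─q⊆p S ⁅ u ⁆ y∈S-u) (x∈p-y⇒x≢y y∈S-u))
      ... | inj₂ x∈S-u | inj₁ y∈⁅v⁆ rewrite x∈⁅y⁆⇒x≡y v y∈⁅v⁆ =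
        separated-from-dominated (p─q⊆p S ⁅ u ⁆ x∈S-u) (x∈p-y⇒x≢y x∈S-u)
      ... | inj₂ x∈S-u | inj₂ y∈S-u =
        proj₂ S-packing x y (p─q⊆p S ⁅ u ⁆ x∈S-u) (p─q⊆p S ⁅ u ⁆ y∈S-u) x≢y

    u∉exchanged : u ∉ exchanged
    u∉exchanged u∈ with x∈p∪q⁻ ⁅ v ⁆ (S - u) u∈
    ... | inj₁ u∈⁅v⁆ = N-irrefl v∈Nu (sym (x∈⁅y⁆⇒x≡y v u∈⁅v⁆))
    ... | inj₂ u∈S-u = x∈p-y⇒x≢y u∈S-u refl

    ∣S∣≤∣exchanged∣ : ∣ S ∣ ≤ ∣ exchanged ∣
    ∣S∣≤∣exchanged∣ = begin
      ∣ S ∣                   ≤⟨ p⊆q⇒∣p∣≤∣q∣ S⊆u∪S-u ⟩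
      ∣ ⁅ u ⁆ ∪ (S - u) ∣     ≤⟨ ∣p∪q∣≤∣p∣+∣q∣ ⁅ u ⁆ (S - u) ⟩
      ∣ ⁅ u ⁆ ∣ + ∣ S - u ∣   ≡⟨ cong (_+ ∣ S - u ∣) (∣⁅x⁆∣≡1 u) ⟩
      1 + ∣ S - u ∣           ≤⟨ p⊂q⇒∣p∣<∣q∣ S-u⊂exchanged ⟩
      ∣ exchanged ∣           ∎
      where
      open ≤-Reasoning

      S⊆u∪S-u : S ⊆ ⁅ u ⁆ ∪ (S - u)
      S⊆u∪S-u {x} x∈S with x ≟ᶠ u
      ... | yes refl = x∈p∪q⁺ (inj₁ (x∈⁅x⁆ u))
      ... | no x≢u   = x∈p∪q⁺ (inj₂ (x∈p∧x≢y⇒x∈p-y x∈S x≢u))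

      v∉S-u : v ∉ S - u
      v∉S-u v∈S-u =
        ∉-tabulate⁺ (proj₁ (proj₂ S-packing v u (p─q⊆p S ⁅ u ⁆ v∈S-u) u∈S (x∈p-y⇒x≢y v∈S-u))) v∈Nu

      S-u⊂exchanged : S - u ⊂ exchanged
      S-u⊂exchanged = (λ x∈ → x∈p∪q⁺ (inj₂ x∈)) , v , x∈p∪q⁺ (inj₁ (x∈⁅x⁆ v)) , v∉S-u

  ∅-packing : Is2Packing G ⊥
  ∅-packing = (λ x∈⊥ → contradiction x∈⊥ ∉⊥) , λ x _ x∈⊥ → contradiction x∈⊥ ∉⊥

  max-2packing-avoiding : ∀ {u v} → v ∈ N G u → N[_] G v ⊆ N[_] G u → N² G v ⊆ N G u →
                          ∃ λ S → IsMax2Packing G S × u ∉ S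
  max-2packing-avoiding {u} v∈Nu N[v]⊆N[u] N²v⊆Nu with maximum-subset Is2Packing? ∅-packing
  ... | S , S-packing , S-max with u ∈? S
  ...   | no  u∉S = S , (S-packing , S-max) , u∉S
  ...   | yes u∈S =
    exchanged , (exchanged-packing , λ T T-packing → ≤-trans (S-max T T-packing) ∣S∣≤∣exchanged∣) ,
    u∉exchanged
    where open Exchange v∈Nu N[v]⊆N[u] N²v⊆Nu S-packing u∈S

module _ {n : ℕ} (G : ExtGraph n) {U : Subset n} (U⊆V : U ⊆ ExtGraph.V G) where

  Separated-induced : ∀ {x y} → x ∈ U → y ∈ U → Separated (induced G U) x y ≡ Separated G x y
  Separated-induced x∈U y∈U
    rewrite []=⇒lookup x∈U | []=⇒lookup y∈U | []=⇒lookup (U⊆V x∈U) | []=⇒lookup (U⊆V y∈U) = refl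

  packing-induced⁻ : ∀ {T} → Is2Packing (induced G U) T → Is2Packing G T
  packing-induced⁻ (T⊆U , separated) = U⊆V ∘ T⊆U , λ x y x∈T y∈T x≢y →
    subst id (Separated-induced (T⊆U x∈T) (T⊆U y∈T)) (separated x y x∈T y∈T x≢y)

  packing-induced⁺ : ∀ {T} → T ⊆ U → Is2Packing G T → Is2Packing (induced G U) T
  packing-induced⁺ T⊆U (_ , separated) = T⊆U , λ x y x∈T y∈T x≢y →
    subst id (sym (Separated-induced (T⊆U x∈T) (T⊆U y∈T))) (separated x y x∈T y∈T x≢y)

  packingNumber-induced : ∀ {S} → IsMax2Packing G S → S ⊆ U →
                          ∀ k → HasPackingNumber G k ⇔ HasPackingNumber (induced G U) k
  packingNumber-induced {S} (S-packing , S-max) S⊆U k = mk⇔ to from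
    where
    S-packing-in-U : Is2Packing (induced G U) S
    S-packing-in-U = packing-induced⁺ S⊆U S-packing

    to : HasPackingNumber G k → HasPackingNumber (induced G U) k
    to ((T , T-packing , ∣T∣≡k) , k-max) =
      (S , S-packing-in-U ,
       ≤-antisym (k-max S S-packing) (subst (_≤ ∣ S ∣) ∣T∣≡k (S-max T T-packing))) ,
      λ R R-packing → k-max R (packing-induced⁻ R-packing)

    from : HasPackingNumber (induced G U) k → HasPackingNumber G k
    from ((T , T-packing , ∣T∣≡k) , k-max) =
      (T , packing-induced⁻ T-packing , ∣T∣≡k) ,
      λ R R-packing → ≤-trans (S-max R R-packing) (k-max S S-packing-in-U)

mainTheorem10 : ∀ {n} (G : ExtGraph n) (u v : Fin n) →
    u ∈ ExtGraph.V G → v ∈ ExtGraph.V G → ¬ (u ≡ v) →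
    N[_] G v ⊆ N[_] G u →
    deg₂ G v + deg G v ≤ deg G u →
    (∃ λ S → IsMax2Packing G S × u ∉ S)
    × (∀ k → HasPackingNumber G k ⇔ HasPackingNumber (deleteVertex G u) k)
mainTheorem10 G u v _ v∈V u≢v N[v]⊆N[u] deg-bound =
  let v∈Nu : v ∈ N G u
      v∈Nu = ∈N-dominated G v∈V u≢v N[v]⊆N[u]
      (S , S-max , u∉S) = max-2packing-avoiding G v∈Nu N[v]⊆N[u]
                            (N²⊆N-of-heavy-neighbour G v∈Nu deg-bound)
      S⊆V-u : S ⊆ ExtGraph.V G - u
      S⊆V-u x∈S = x∈p∧x≢y⇒x∈p-y (proj₁ (proj₁ S-max) x∈S) λ { refl → u∉S x∈S }
  in (S , S-max , u∉S) , packingNumber-induced G (p─q⊆p (ExtGraph.V G) ⁅ u ⁆) S-max S⊆V-u
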